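{- Let $\mathcal B$ be any board, let $q'>q>0$ be integers, and let $\mathsf P,\mathsf P'$ be pieces such that every basic move of $\mathsf P$ is also a basic move of $\mathsf P'$. Then $D_q(\mathsf P)$ divides $D_{q'}(\mathsf P)$ and $D_q(\mathsf P)$ divides $D_q(\mathsf P')$.
   Context: A board $\mathcal B\subset\mathbb R^2$ is a convex polygon with rational corners. A piece $\mathsf P$ is given by a finite set of basic moves: nonzero vectors $m=(c,d)\in\mathbb Z^2$ with $\gcd(c,d)=1$, no one a scalar multiple of another. For $q$ pieces, configurations are points $\mathbf z=(z_1,\dots,z_q)\in\mathbb R^{2q}$; for each basic move $m=(c,d)$ and $1\le i<j\le q$ the move hyperplane is $\mathcal H^m_{ij}=\{\mathbf z:(z_j-z_i)\cdot(d,-c)=0\}$, and $\mathcal A^q_{\mathsf P}$ is the arrangement of these hyperplanes. A vertex of the inside-out polytope $(\mathcal B^q,\mathcal A^q_{\mathsf P})$ is a point of $\mathcal B^q$ that is the unique point of some intersection of move hyperplanes and facet hyperplanes of $\mathcal B^q$ (the latter of the form $\{\mathbf z: z_i\in\mathcal E\}$, $\mathcal E$ an edge line of $\mathcal B$). The denominator $\Delta(\mathbf z)$ of a rational point is the least common denominator of its coordinates, and $D_q(\mathsf P)$ is the least common multiple of $\Delta(\mathbf z)$ over all vertices $\mathbf z$ of $(\mathcal B^q,\mathcal A^q_{\mathsf P})$. -}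

module Defs where

open import Data.Nat as ℕ using (ℕ)
open import Data.Nat.Divisibility using (_∣_)
open import Data.Nat.LCM using (lcm)
open import Data.Integer as ℤ using (ℤ)
open import Data.Integer.GCD as ℤG using ()
open import Data.Rational as ℚ using (ℚ; 0ℚ; _+_; _*_; _-_; _≤_; _<_; ↧ₙ_)
open import Data.Fin as Fin using (Fin)
open import Data.List using (List; foldr; map; allFin)
open import Data.List.Membership.Propositional using (_∈_)
open import Data.List.Relation.Unary.All using (All)
open import Data.List.Relation.Unary.AllPairs using (AllPairs)
open import Data.Product using (_×_; _,_; proj₁; proj₂; Σ; ∃)
open import Relation.Binary.PropositionalEquality using (_≡_)
open import Relation.Nullary using (¬_)

Point : Set
Point = ℚ × ℚ

-- orientation determinant of (b - a, z - a); positive = z strictly left of a→b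
orient : Point → Point → Point → ℚ
orient (a₁ , a₂) (b₁ , b₂) (z₁ , z₂) =
  ((b₁ - a₁) * (z₂ - a₂)) - ((b₂ - a₂) * (z₁ - a₁))

-- Boards: convex polygons with rational corners, given by their
-- n ≥ 3 corners listed counterclockwise (strictly convex position).

next : ∀ {n} → Fin n → Fin n
next {ℕ.suc n} i with Fin.toℕ i ℕ.<? n
... | Relation.Nullary.yes i<n = Fin.suc (Fin.fromℕ< i<n)
... | Relation.Nullary.no _ = Fin.zero

record Board : Set where
  field
    n        : ℕ
    3≤n      : 3 ℕ.≤ n
    corner   : Fin n → Point
    convex   : ∀ (e k : Fin n) → 0ℚ ≤ orient (corner e) (corner (next e)) (corner k)
    strict   : ∀ (e k : Fin n) → ¬ (k ≡ e) → ¬ (k ≡ next e) →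
               0ℚ < orient (corner e) (corner (next e)) (corner k)

open Board public

_∈B_ : Point → Board → Set
z ∈B B = ∀ (e : Fin (n B)) → 0ℚ ≤ orient (corner B e) (corner B (next e)) z

OnEdgeLine : (B : Board) → Fin (n B) → Point → Set
OnEdgeLine B e z = orient (corner B e) (corner B (next e)) z ≡ 0ℚ

Move : Set
Move = ℤ × ℤ

NotParallel : Move → Move → Set
NotParallel (c , d) (c' , d') = ¬ (c ℤ.* d' ≡ d ℤ.* c')

record Piece : Set where
  field
    moves     : List Move
    coprime   : All (λ m → ℤG.gcd (proj₁ m) (proj₂ m) ≡ ℤ.+ 1) moves
    -- (gcd = 1 already forces m ≠ 0)
    distinct  : AllPairs NotParallel moves

open Piece public

Config : ℕ → Set
Config q = Fin q → Point

ℤtoℚ : ℤ → ℚ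
ℤtoℚ k = k ℚ./ 1

dotℚ : Point → Point → ℚ
dotℚ (x₁ , x₂) (y₁ , y₂) = (x₁ * y₁) + (x₂ * y₂)

subP : Point → Point → Point
subP (x₁ , x₂) (y₁ , y₂) = (x₁ - y₁ , x₂ - y₂)

data Hyp (B : Board) (q : ℕ) (P : Piece) : Set where
  moveH  : (m : Move) → m ∈ moves P → (i j : Fin q) → i Fin.< j → Hyp B q P
  facetH : (i : Fin q) → (e : Fin (n B)) → Hyp B q P

_satisfies_ : ∀ {B q P} → Config q → Hyp B q P → Set
z satisfies moveH (c , d) _ i j _ =
  dotℚ (subP (z j) (z i)) (ℤtoℚ d , ℤtoℚ (ℤ.- c)) ≡ 0ℚ
_satisfies_ {B} z (facetH i e) = OnEdgeLine B e (z i)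

InBoardᵠ : Board → (q : ℕ) → Config q → Set
InBoardᵠ B q z = ∀ i → z i ∈B B

IsVertex : (B : Board) (q : ℕ) (P : Piece) → Config q → Set
IsVertex B q P z =
  InBoardᵠ B q z ×
  Σ (List (Hyp B q P)) λ S →
    All (z satisfies_) S ×
    (∀ (w : Config q) → InBoardᵠ B q w → All (w satisfies_) S → ∀ i → w i ≡ z i)

-- denominator Δ(z): least common denominator of all coordinates
-- (ℚ is stored in lowest terms, so this is the lcm of the denominators)
lcmList : List ℕ → ℕ
lcmList = foldr lcm 1

allFinList : (q : ℕ) → List (Fin q)
allFinList q = allFin q

Δ : ∀ {q} → Config q → ℕ
Δ {q} z = lcmList (map (λ i → lcm (↧ₙ proj₁ (z i)) (↧ₙ proj₂ (z i))) (allFinList q))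

IsDenominator : (B : Board) (q : ℕ) (P : Piece) → ℕ → Set
IsDenominator B q P D =
  (∀ z → IsVertex B q P z → Δ z ∣ D) ×
  (∀ M → (∀ z → IsVertex B q P z → Δ z ∣ M) → D ∣ M)

module Submission where

open import Defs
open import Data.Nat using (ℕ; _<_)
open import Data.Nat.Divisibility using (_∣_)
open import Data.List.Membership.Propositional using (_∈_)
open import Data.Product using (_×_)

open import Algebra.Solver.Ring.AlmostCommutativeRing using (fromCommutativeRing)
import Algebra.Properties.Group as GroupProperties
import Algebra.Solver.Ring.Simple as RingSolver
open import Data.Fin using (Fin; zero; suc)
open import Data.List using (List; _∷_; map; allFin)
open import Data.List.Membership.Propositional.Properties using (∈-allFin; ∈-map⁺)
open import Data.List.Relation.Binary.Subset.Propositional using (_⊆_)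
open import Data.List.Relation.Unary.All as All using (All; []; _∷_)
open import Data.List.Relation.Unary.All.Properties using (map⁺; map⁻)
open import Data.List.Relation.Unary.Any using (here; there)
open import Data.Nat as ℕ using (_≤′_; ≤′-refl; ≤′-step; s≤s; z≤n)
open import Data.Nat.Divisibility using (∣-refl; ∣-trans; 1∣_)
open import Data.Nat.LCM using (lcm; m∣lcm[m,n]; n∣lcm[m,n]; lcm-least)
open import Data.Nat.Properties using (≤⇒≤′; <⇒≤)
open import Data.Product using (Σ-syntax; _,_; proj₁; proj₂)
open import Data.Rational as ℚ using (ℚ; 0ℚ; 1ℚ; 1/_; _*_; _-_)
open import Data.Rational.Properties
  using (+-*-commutativeRing; +-0-group; *-inverseˡ; *-assoc; *-zeroʳ; *-identityˡ)
open import Data.Vec.Functional using (tail) renaming (_∷_ to _∷ᵥ_)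
open import Function using (_∘_)
open import Relation.Binary.PropositionalEquality
  using (_≡_; _≢_; refl; sym; trans; cong; cong₂; module ≡-Reasoning)

open RingSolver (fromCommutativeRing +-*-commutativeRing) ℚ._≟_
  using (solve; _:*_; _:-_; _:=_; con)

-- Adding a piece on a corner of the board turns a vertex for q pieces into
-- one for q + 1: the new piece is pinned by the facet hyperplanes of the two
-- edges meeting at the corner, and the old pieces keep their position, so the
-- old denominator divides the new one.  A vertex for P is a vertex for P'
-- because each hyperplane of A_P is one of A_P'.  Thus each Δ(z) counted in
-- D_q(P) divides a Δ(w) counted in D_q'(P) resp. D_q(P').

orient[a,b,b]≡0 : ∀ a b → orient a b b ≡ 0ℚ
orient[a,b,b]≡0 (a₁ , a₂) (b₁ , b₂) =
  solve 4 (λ a₁ a₂ b₁ b₂ →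
    ((b₁ :- a₁) :* (b₂ :- a₂)) :- ((b₂ :- a₂) :* (b₁ :- a₁)) := con 0ℚ) refl a₁ a₂ b₁ b₂

orient[a,b,a]≡0 : ∀ a b → orient a b a ≡ 0ℚ
orient[a,b,a]≡0 (a₁ , a₂) (b₁ , b₂) =
  solve 4 (λ a₁ a₂ b₁ b₂ →
    ((b₁ :- a₁) :* (a₂ :- a₂)) :- ((b₂ :- a₂) :* (a₁ :- a₁)) := con 0ℚ) refl a₁ a₂ b₁ b₂

-- Cramer's rule: orient a b c ≠ 0 makes w - b a combination of orient a b w and orient b c w.
orient-cramer₁ : ∀ a₁ a₂ b₁ b₂ c₁ c₂ w₁ w₂ →
  orient (a₁ , a₂) (b₁ , b₂) (c₁ , c₂) * (w₁ - b₁)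
  ≡ (c₁ - b₁) * orient (a₁ , a₂) (b₁ , b₂) (w₁ , w₂)
    - (b₁ - a₁) * orient (b₁ , b₂) (c₁ , c₂) (w₁ , w₂)
orient-cramer₁ = solve 8 (λ a₁ a₂ b₁ b₂ c₁ c₂ w₁ w₂ →
  (((b₁ :- a₁) :* (c₂ :- a₂)) :- ((b₂ :- a₂) :* (c₁ :- a₁))) :* (w₁ :- b₁)
  := ((c₁ :- b₁) :* (((b₁ :- a₁) :* (w₂ :- a₂)) :- ((b₂ :- a₂) :* (w₁ :- a₁))))
    :- ((b₁ :- a₁) :* (((c₁ :- b₁) :* (w₂ :- b₂)) :- ((c₂ :- b₂) :* (w₁ :- b₁))))) refl

orient-cramer₂ : ∀ a₁ a₂ b₁ b₂ c₁ c₂ w₁ w₂ →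
  orient (a₁ , a₂) (b₁ , b₂) (c₁ , c₂) * (w₂ - b₂)
  ≡ (c₂ - b₂) * orient (a₁ , a₂) (b₁ , b₂) (w₁ , w₂)
    - (b₂ - a₂) * orient (b₁ , b₂) (c₁ , c₂) (w₁ , w₂)
orient-cramer₂ = solve 8 (λ a₁ a₂ b₁ b₂ c₁ c₂ w₁ w₂ →
  (((b₁ :- a₁) :* (c₂ :- a₂)) :- ((b₂ :- a₂) :* (c₁ :- a₁))) :* (w₂ :- b₂)
  := ((c₂ :- b₂) :* (((b₁ :- a₁) :* (w₂ :- a₂)) :- ((b₂ :- a₂) :* (w₁ :- a₁))))
    :- ((b₂ :- a₂) :* (((c₁ :- b₁) :* (w₂ :- b₂)) :- ((c₂ :- b₂) :* (w₁ :- b₁))))) refl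

p*0-q*0≡0 : ∀ p q → p * 0ℚ - q * 0ℚ ≡ 0ℚ
p*0-q*0≡0 = solve 2 (λ p q → (p :* con 0ℚ) :- (q :* con 0ℚ) := con 0ℚ) refl

p*q≡0⇒q≡0 : ∀ p q .{{_ : ℚ.NonZero p}} → p * q ≡ 0ℚ → q ≡ 0ℚ
p*q≡0⇒q≡0 p q pq≡0 = begin
  q                  ≡⟨ sym (*-identityˡ q) ⟩
  1ℚ * q             ≡⟨ cong (_* q) (sym (*-inverseˡ p)) ⟩
  (1/ p * p) * q     ≡⟨ *-assoc (1/ p) p q ⟩
  1/ p * (p * q)     ≡⟨ cong (1/ p *_) pq≡0 ⟩
  1/ p * 0ℚ          ≡⟨ *-zeroʳ (1/ p) ⟩
  0ℚ                 ∎
  where open ≡-Reasoning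

p-q≡0⇒p≡q : ∀ p q → p - q ≡ 0ℚ → p ≡ q
p-q≡0⇒p≡q = GroupProperties.x∙y⁻¹≈ε⇒x≈y +-0-group

edge-lines-meet-only-at-corner : ∀ a b c w → 0ℚ ℚ.< orient a b c →
  orient a b w ≡ 0ℚ → orient b c w ≡ 0ℚ → w ≡ b
edge-lines-meet-only-at-corner a@(a₁ , a₂) b@(b₁ , b₂) c@(c₁ , c₂) w@(w₁ , w₂) turn abw≡0 bcw≡0 =
  cong₂ _,_ (p-q≡0⇒p≡q w₁ b₁ (p*q≡0⇒q≡0 (orient a b c) (w₁ - b₁) cramer₁))
            (p-q≡0⇒p≡q w₂ b₂ (p*q≡0⇒q≡0 (orient a b c) (w₂ - b₂) cramer₂))
  where
  instance
    abc≢0 : ℚ.NonZero (orient a b c)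
    abc≢0 = ℚ.>-nonZero turn

  vanish : ∀ s t → s * orient a b w - t * orient b c w ≡ 0ℚ
  vanish s t = trans (cong₂ (λ x y → s * x - t * y) abw≡0 bcw≡0) (p*0-q*0≡0 s t)

  cramer₁ : orient a b c * (w₁ - b₁) ≡ 0ℚ
  cramer₁ = trans (orient-cramer₁ a₁ a₂ b₁ b₂ c₁ c₂ w₁ w₂) (vanish (c₁ - b₁) (b₁ - a₁))

  cramer₂ : orient a b c * (w₂ - b₂) ≡ 0ℚ
  cramer₂ = trans (orient-cramer₂ a₁ a₂ b₁ b₂ c₁ c₂ w₁ w₂) (vanish (c₂ - b₂) (b₂ - a₂))

next²-fresh : ∀ {n} → 3 ℕ.≤ n →
  Σ[ e ∈ Fin n ] next (next e) ≢ e × next (next e) ≢ next e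
next²-fresh (s≤s (s≤s (s≤s z≤n))) = zero , (λ ()) , (λ ())

strictly-convex-corner : (B : Board) →
  Σ[ e ∈ Fin (n B) ] 0ℚ ℚ.< orient (corner B e) (corner B (next e)) (corner B (next (next e)))
strictly-convex-corner B with next²-fresh (3≤n B)
... | e , ≢e , ≢next-e = e , strict B e (next (next e)) ≢e ≢next-e

∈⇒∣lcmList : ∀ {x xs} → x ∈ xs → x ∣ lcmList xs
∈⇒∣lcmList {xs = x ∷ xs} (here refl) = m∣lcm[m,n] x (lcmList xs)
∈⇒∣lcmList {xs = y ∷ xs} (there x∈xs) = ∣-trans (∈⇒∣lcmList x∈xs) (n∣lcm[m,n] y (lcmList xs))

lcmList-least : ∀ {M xs} → All (_∣ M) xs → lcmList xs ∣ M
lcmList-least {M} []         = 1∣ M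
lcmList-least (x∣M ∷ xs∣M) = lcm-least x∣M (lcmList-least xs∣M)

Δ-∘-∣ : ∀ {q q'} (w : Config q') (f : Fin q → Fin q') → Δ (w ∘ f) ∣ Δ w
Δ-∘-∣ {q} w f = lcmList-least (map⁺ (All.tabulate {xs = allFin q} λ {i} _ →
  ∈⇒∣lcmList (∈-map⁺ (λ j → lcm (ℚ.↧ₙ proj₁ (w j)) (ℚ.↧ₙ proj₂ (w j))) (∈-allFin (f i)))))

IsDenominator-∣ : ∀ {B B' q q' P P' D D'} →
  IsDenominator B q P D → IsDenominator B' q' P' D' →
  (∀ z → IsVertex B q P z → Σ[ w ∈ Config q' ] IsVertex B' q' P' w × Δ z ∣ Δ w) →
  D ∣ D'
IsDenominator-∣ {D' = D'} (_ , D-least) (D'-bound , _) dominated = D-least D' λ z z-vertex →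
  let w , w-vertex , Δz∣Δw = dominated z z-vertex in ∣-trans Δz∣Δw (D'-bound w w-vertex)

module _ {B : Board} {q : ℕ} {P P' : Piece} (P⊆P' : moves P ⊆ moves P') where

  widenHyp : Hyp B q P → Hyp B q P'
  widenHyp (moveH m m∈P i j i<j) = moveH m (P⊆P' m∈P) i j i<j
  widenHyp (facetH i e)          = facetH i e

  satisfies-widen⁺ : ∀ (z : Config q) (h : Hyp B q P) → z satisfies h → z satisfies widenHyp h
  satisfies-widen⁺ z (moveH _ _ _ _ _) sat = sat
  satisfies-widen⁺ z (facetH _ _)      sat = sat

  satisfies-widen⁻ : ∀ (z : Config q) (h : Hyp B q P) → z satisfies widenHyp h → z satisfies h
  satisfies-widen⁻ z (moveH _ _ _ _ _) sat = sat
  satisfies-widen⁻ z (facetH _ _)      sat = sat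

  IsVertex-widen : ∀ {z} → IsVertex B q P z → IsVertex B q P' z
  IsVertex-widen {z} (z∈B , S , z-sat , unique) =
    z∈B , map widenHyp S , map⁺ (All.map (satisfies-widen⁺ z _) z-sat) ,
    λ w w∈B w-sat → unique w w∈B (All.map (satisfies-widen⁻ w _) (map⁻ w-sat))

shiftHyp : ∀ {B q P} → Hyp B q P → Hyp B (ℕ.suc q) P
shiftHyp (moveH m m∈P i j i<j) = moveH m m∈P (suc i) (suc j) (s≤s i<j)
shiftHyp (facetH i e)          = facetH (suc i) e

satisfies-shift⁺ : ∀ {B q P} (x : Point) (z : Config q) (h : Hyp B q P) →
  z satisfies h → (x ∷ᵥ z) satisfies shiftHyp h
satisfies-shift⁺ x z (moveH _ _ _ _ _) sat = sat
satisfies-shift⁺ x z (facetH _ _)      sat = sat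

satisfies-shift⁻ : ∀ {B q P} (w : Config (ℕ.suc q)) (h : Hyp B q P) →
  w satisfies shiftHyp h → tail w satisfies h
satisfies-shift⁻ w (moveH _ _ _ _ _) sat = sat
satisfies-shift⁻ w (facetH _ _)      sat = sat

module _ {B : Board} {P : Piece} {e : Fin (n B)}
  (turn : 0ℚ ℚ.< orient (corner B e) (corner B (next e)) (corner B (next (next e)))) where

  private
    a b c : Point
    a = corner B e
    b = corner B (next e)
    c = corner B (next (next e))

  IsVertex-cons-corner : ∀ {q} {z : Config q} →
    IsVertex B q P z → IsVertex B (ℕ.suc q) P (b ∷ᵥ z)
  IsVertex-cons-corner {q} {z} (z∈B , S , z-sat , unique) = ∷z∈B , S' , ∷z-sat , ∷z-unique
    where
    ∷z∈B : InBoardᵠ B (ℕ.suc q) (b ∷ᵥ z)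
    ∷z∈B zero    e' = convex B e' (next e)
    ∷z∈B (suc i)    = z∈B i

    S' : List (Hyp B (ℕ.suc q) P)
    S' = facetH zero e ∷ facetH zero (next e) ∷ map shiftHyp S

    ∷z-sat : All ((b ∷ᵥ z) satisfies_) S'
    ∷z-sat = orient[a,b,b]≡0 a b
           ∷ orient[a,b,a]≡0 b c
           ∷ map⁺ (All.map (satisfies-shift⁺ {B} {q} {P} b z _) z-sat)

    ∷z-unique : ∀ w → InBoardᵠ B (ℕ.suc q) w → All (w satisfies_) S' →
      ∀ i → w i ≡ (b ∷ᵥ z) i
    ∷z-unique w _ (on-e ∷ on-next-e ∷ _) zero =
      edge-lines-meet-only-at-corner a b c (w zero) turn on-e on-next-e
    ∷z-unique w w∈B (_ ∷ _ ∷ shifted-sat) (suc i) =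
      unique (tail w) (w∈B ∘ suc) (All.map (satisfies-shift⁻ {B} {q} {P} w _) (map⁻ shifted-sat)) i

  vertex-extend : ∀ {q q'} → q ≤′ q' → ∀ z → IsVertex B q P z →
    Σ[ w ∈ Config q' ] IsVertex B q' P w × Δ z ∣ Δ w
  vertex-extend ≤′-refl        z z-vertex = z , z-vertex , ∣-refl
  vertex-extend (≤′-step q≤′q') z z-vertex =
    let w , w-vertex , Δz∣Δw = vertex-extend q≤′q' z z-vertex
    in b ∷ᵥ w , IsVertex-cons-corner w-vertex , ∣-trans Δz∣Δw (Δ-∘-∣ (b ∷ᵥ w) suc)

proposition2p2 : (B : Board) (q q' : ℕ) → 0 < q → q < q' →
    (P P' : Piece) → (∀ m → m ∈ moves P → m ∈ moves P') →
    ∀ Dq Dq' DqP' →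
    IsDenominator B q P Dq → IsDenominator B q' P Dq' → IsDenominator B q P' DqP' →
    (Dq ∣ Dq') × (Dq ∣ DqP')
proposition2p2 B q q' _ q<q' P P' P⊆P' Dq Dq' DqP' isDq isDq' isDqP' =
  IsDenominator-∣ isDq isDq' (vertex-extend turn (≤⇒≤′ (<⇒≤ q<q'))) ,
  IsDenominator-∣ isDq isDqP' (λ z z-vertex → z , IsVertex-widen (λ {m} → P⊆P' m) z-vertex , ∣-refl)
  where turn = proj₂ (strictly-convex-corner B)
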